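{- Let $w$ be an infinite word beginning with $0$ generated by a morphism $\phi$ with $\det A_\phi=\pm1$. Then $w$ satisfies the WELLDOC property if and only if $w$ satisfies WELLDOC for $0$.
   Context: $\Sigma=\{0,\dots,\sigma-1\}$. A morphism is nonerasing; $w$ is generated by $\phi$ if $\phi(0)=0s$ with $s$ nonempty and $w=\lim_n\phi^n(0)$. $A_\phi$ is the $\sigma\times\sigma$ matrix with entry $|\phi(i)|_j$ in row $j$, column $i$. Parikh vector $V_u=(|u|_0,\dots,|u|_{\sigma-1})$; for a factor $u$ occurring at positions $a_0<a_1<\dots$, $X_u=\{V_{w[0,a_i)}\}$, $X_{u,m}$ its reduction mod $m$. WELLDOC: $X_{u,m}=(\mathbb{Z}/m\mathbb{Z})^\sigma$ for all $m\ge1$ and all factors $u$. WELLDOC for $0$: $X_{0,m}=(\mathbb{Z}/m\mathbb{Z})^\sigma$ for all $m\ge1$ (i.e. only for the factor $u=0$). -}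

module Defs where

open import Data.Nat using (ℕ; zero; suc; _+_; _%_; NonZero)
open import Data.Fin using (Fin; zero; suc; toℕ; punchIn; _≟_)
open import Data.List using (List; []; _∷_; length; applyUpTo; concatMap; filter)
open import Data.Integer as ℤ using (ℤ; +_; -_; 1ℤ)
open import Data.Product using (∃; ∃-syntax; _×_)
open import Relation.Binary.PropositionalEquality using (_≡_; _≢_)

-- Alphabet Σ = Fin σ; letter 0 is Fin.zero.
Word : ℕ → Set
Word σ = List (Fin σ)

InfWord : ℕ → Set
InfWord σ = ℕ → Fin σ

Morphism : ℕ → Set
Morphism σ = Fin σ → Word σ

Nonerasing : ∀ {σ} → Morphism σ → Set
Nonerasing φ = ∀ i → φ i ≢ []

apply : ∀ {σ} → Morphism σ → Word σ → Word σ
apply φ = concatMap φ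

iter : ∀ {σ} → Morphism σ → ℕ → Word σ → Word σ
iter φ zero    u = u
iter φ (suc k) u = apply φ (iter φ k u)

prefix : ∀ {σ} → InfWord σ → ℕ → Word σ
prefix w n = applyUpTo w n

factorAt : ∀ {σ} → InfWord σ → ℕ → ℕ → Word σ
factorAt w a n = applyUpTo (λ i → w (a + i)) n

-- w is generated by φ: φ(0) = 0 s with s nonempty, and w = lim φ^n(0),
-- i.e. every φ^n(0) is a prefix of w (their lengths tend to infinity).
GeneratedBy : ∀ {n} → Morphism (suc n) → InfWord (suc n) → Set
GeneratedBy φ w =
  Nonerasing φ ×
  (∃[ s ] (φ zero ≡ zero ∷ s × s ≢ [])) ×
  (∀ k → prefix w (length (iter φ k (zero ∷ []))) ≡ iter φ k (zero ∷ []))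

occ : ∀ {σ} → Fin σ → Word σ → ℕ
occ j u = length (filter (_≟ j) u)

Matrix : ℕ → Set
Matrix σ = Fin σ → Fin σ → ℤ

incidence : ∀ {σ} → Morphism σ → Matrix σ
incidence φ j i = + occ j (φ i)

minor : ∀ {n} → Fin (suc n) → Matrix (suc n) → Matrix n
minor j M r c = M (suc r) (punchIn j c)

sign : ℕ → ℤ
sign zero          = 1ℤ
sign (suc zero)    = - 1ℤ
sign (suc (suc k)) = sign k

sumFin : ∀ n → (Fin n → ℤ) → ℤ
sumFin zero    f = + 0
sumFin (suc n) f = f zero ℤ.+ sumFin n (λ i → f (suc i))

det : ∀ {n} → Matrix n → ℤ
det {zero}  M = 1ℤ
det {suc n} M = sumFin (suc n) (λ j → sign (toℕ j) ℤ.* (M zero j ℤ.* det (minor j M)))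

OccursAt : ∀ {σ} → InfWord σ → Word σ → ℕ → Set
OccursAt w u a = factorAt w a (length u) ≡ u

IsFactor : ∀ {σ} → InfWord σ → Word σ → Set
IsFactor w u = ∃[ a ] OccursAt w u a

-- X_{u,m} = (ℤ/mℤ)^σ : every residue vector is the Parikh vector (mod m)
-- of the prefix w[0,a) for some occurrence a of u.
FullResidues : ∀ {σ} → InfWord σ → Word σ → Set
FullResidues {σ} w u =
  ∀ (m : ℕ) .{{_ : NonZero m}} (v : Fin σ → Fin m) →
    ∃[ a ] (OccursAt w u a × (∀ j → occ j (prefix w a) % m ≡ toℕ (v j)))

WELLDOC : ∀ {σ} → InfWord σ → Set
WELLDOC w = ∀ u → IsFactor w u → FullResidues w u

WELLDOC-for-0 : ∀ {n} → InfWord (suc n) → Set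
WELLDOC-for-0 w = FullResidues w (zero ∷ [])

{-# OPTIONS --safe #-}

-- Let u occur in w at position b, let v be a residue vector modulo m, and put K = b + |u|.
-- Since det A_φ = ±1, the adjugate shows that A_φ, hence A_φ^K, maps ℤ^σ onto itself, so
-- some x satisfies A_φ^K x = v - V(w[0,b)).  WELLDOC for 0 gives an occurrence a of 0 with
-- V(w[0,a)) ≡ x (mod m).  Because w is the fixed point of φ, both Y φ^K(0) = φ^K(w[0,a]),
-- where Y = φ^K(w[0,a)), and φ^K(0) are prefixes of w, and |φ^K(0)| > K ≥ b + |u|.  Hence
-- w[0, |Y| + b + |u|) = Y w[0,b) u: the factor u occurs at |Y| + b, and the Parikh vector
-- of the prefix before it is A_φ^K V(w[0,a)) + V(w[0,b)) ≡ v (mod m).  The converse holds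
-- because 0 = w(0) is itself a factor of w.

module Submission where

open import Defs
open import Data.Fin using (Fin; zero; suc; toℕ; fromℕ<; punchIn; punchOut; _≟_)
open import Data.Fin.Properties
  using (toℕ<n; toℕ-fromℕ<; punchInᵢ≢i; punchIn-punchOut; punchOut-punchIn; punchOut-cong)
open import Data.Integer as ℤ
  using (ℤ; +_; -_; 0ℤ; 1ℤ; -1ℤ; +[1+_]; -[1+_]; _+_; _-_; _*_; _%ℕ_; _/ℕ_)
open import Data.Integer.DivMod using (a≡a%ℕn+[a/ℕn]*n; n%ℕd<d)
import Data.Integer.Properties as ℤP
open import Algebra.Properties.Semiring.Sum ℤP.+-*-semiring
  using (sum; sum-syntax; sum-cong-≗; sum-remove; sum-replicate-zero; ∑-distrib-+; ∑-comm;
         *-distribˡ-sum; *-distribʳ-sum)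
open import Data.Integer.Tactic.RingSolver using (solve-∀)
open import Data.List using (List; []; _∷_; _++_; [_]; length; filter; applyUpTo; upTo; map)
open import Data.List.Properties
  using (∷-injective; ∷-injectiveˡ; length-++; length-applyUpTo; applyUpTo-∷ʳ; map-cong; map-upTo;
         filter-++; filter-accept; filter-reject; concatMap-++)
open import Data.Nat as ℕ using (ℕ; zero; suc; _≤_; _<_; _∸_; z≤n; s≤s; NonZero)
open import Data.Nat.DivMod using (_%_; %-congˡ; [m+kn]%n≡m%n; m<n⇒m%n≡m)
import Data.Nat.Properties as ℕP
open import Data.Product using (∃-syntax; Σ-syntax; _×_; _,_; proj₁; proj₂; map₁)
open import Data.Sum using (_⊎_; inj₁; inj₂)
open import Data.Vec.Functional using (Vector; removeAt) renaming (_∷_ to _∷ᵥ_)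
open import Function.Base using (_∘_)
open import Function.Bundles using (_⇔_; mk⇔)
open import Relation.Binary.PropositionalEquality
  using (_≡_; _≢_; _≗_; refl; sym; trans; cong; cong₂; subst; subst₂; module ≡-Reasoning)
open import Relation.Nullary using (yes; no; contradiction)

open ≡-Reasoning

-- Sums and signs

sumFin≡sum : ∀ n (f : Vector ℤ n) → sumFin n f ≡ sum f
sumFin≡sum zero    f = refl
sumFin≡sum (suc n) f = cong (_+_ (f zero)) (sumFin≡sum n (f ∘ suc))

sum-zero : ∀ n {f : Vector ℤ n} → (∀ i → f i ≡ 0ℤ) → sum f ≡ 0ℤ
sum-zero n f≗0 = trans (sum-cong-≗ f≗0) (sum-replicate-zero n)

neg-sum : ∀ {n} (f : Vector ℤ n) → - sum f ≡ ∑[ i < n ] (- f i)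
neg-sum f = begin
  - sum f                ≡⟨ ℤP.-1*i≡-i (sum f) ⟨
  -1ℤ * sum f            ≡⟨ *-distribˡ-sum -1ℤ f ⟩
  sum (λ i → -1ℤ * f i)  ≡⟨ sum-cong-≗ (ℤP.-1*i≡-i ∘ f) ⟩
  sum (λ i → - f i)      ∎

sgn : ∀ {n} → Fin n → ℤ
sgn i = sign (toℕ i)

sign-suc : ∀ k → sign (suc k) ≡ - sign k
sign-suc zero          = refl
sign-suc (suc zero)    = refl
sign-suc (suc (suc k)) = sign-suc k

sign-±1 : ∀ k → sign k ≡ 1ℤ ⊎ sign k ≡ - 1ℤ
sign-±1 zero          = inj₁ refl
sign-±1 (suc zero)    = inj₂ refl
sign-±1 (suc (suc k)) = sign-±1 k

±1-square : ∀ {x} → x ≡ 1ℤ ⊎ x ≡ - 1ℤ → x * x ≡ 1ℤ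
±1-square (inj₁ refl) = refl
±1-square (inj₂ refl) = refl

sgn-square : ∀ {n} (i : Fin n) → sgn i * sgn i ≡ 1ℤ
sgn-square i = ±1-square (sign-±1 (toℕ i))

self-neg⇒0 : ∀ x → x ≡ - x → x ≡ 0ℤ
self-neg⇒0 (+ zero) _  = refl
self-neg⇒0 +[1+ _ ] ()
self-neg⇒0 -[1+ _ ] ()

punchIn-punchOut-comm : ∀ {n} {i j : Fin (suc (suc n))} (i≢j : i ≢ j) (j≢i : j ≢ i) (k : Fin n) →
  punchIn i (punchIn (punchOut i≢j) k) ≡ punchIn j (punchIn (punchOut j≢i) k)
punchIn-punchOut-comm {i = zero}  {zero}  i≢j _ _ = contradiction refl i≢j
punchIn-punchOut-comm {i = zero}  {suc j} _ _ _ = refl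
punchIn-punchOut-comm {i = suc i} {zero}  _ _ _ = refl
punchIn-punchOut-comm {suc n} {suc i} {suc j} _ _ zero = refl
punchIn-punchOut-comm {suc n} {suc i} {suc j} i≢j j≢i (suc k) =
  cong suc (punchIn-punchOut-comm (i≢j ∘ cong suc) (j≢i ∘ cong suc) k)

sgn-punchOut : ∀ {n} {i j : Fin (suc (suc n))} (i≢j : i ≢ j) (j≢i : j ≢ i) →
  sgn j * sgn (punchOut j≢i) ≡ - (sgn i * sgn (punchOut i≢j))
sgn-punchOut {i = zero} {zero} i≢j _ = contradiction refl i≢j
sgn-punchOut {i = zero} {suc j} _ _ rewrite sign-suc (toℕ j) = neg-swap (sgn j)
  where neg-swap : ∀ x → - x * 1ℤ ≡ - (1ℤ * x)
        neg-swap = solve-∀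
sgn-punchOut {i = suc i} {zero} _ _ rewrite sign-suc (toℕ i) = neg-swap (sgn i)
  where neg-swap : ∀ x → 1ℤ * x ≡ - (- x * 1ℤ)
        neg-swap = solve-∀
sgn-punchOut {zero} {suc zero} {suc zero} i≢j _ = contradiction refl i≢j
sgn-punchOut {suc n} {suc i} {suc j} i≢j j≢i
  rewrite sign-suc (toℕ i) | sign-suc (toℕ j)
        | sign-suc (toℕ (punchOut (i≢j ∘ cong suc))) | sign-suc (toℕ (punchOut (j≢i ∘ cong suc))) = begin
    - sgn j * - sgn q      ≡⟨ neg-*-neg (sgn j) (sgn q) ⟩
    sgn j * sgn q          ≡⟨ sgn-punchOut (i≢j ∘ cong suc) (j≢i ∘ cong suc) ⟩
    - (sgn i * sgn p)      ≡⟨ cong -_ (neg-*-neg (sgn i) (sgn p)) ⟨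
    - (- sgn i * - sgn p)  ∎
  where
  p = punchOut (i≢j ∘ cong suc)
  q = punchOut (j≢i ∘ cong suc)
  neg-*-neg : ∀ x y → - x * - y ≡ x * y
  neg-*-neg = solve-∀

-- Determinants

-- Φ x y is a determinant with first rows x and y, expanded along both of them; D a l is the
-- minor of the remaining rows at the columns left after deleting column a and then column l,
-- and D-sym says that deleting two columns in either order leaves the same minor.
module TwoRowExpansion {n : ℕ} (D : Fin (suc (suc n)) → Fin (suc n) → ℤ)
  (D-sym : ∀ {a b} (a≢b : a ≢ b) (b≢a : b ≢ a) → D a (punchOut a≢b) ≡ D b (punchOut b≢a)) where

  private
    N : ℕ
    N = suc (suc n)

  Φ : Vector ℤ N → Vector ℤ N → ℤ
  Φ x y = sumFin N (λ a → sgn a * (x a * sumFin (suc n) (λ l → sgn l * (y (punchIn a l) * D a l))))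

  -- Re-indexed by the ordered pair (a, b) of columns used by the two rows, with coefficient 0
  -- on the diagonal, Φ becomes a bilinear form whose coefficients are antisymmetric.
  private
    coeff : Fin N → Fin N → ℤ
    coeff a b with a ≟ b
    ... | yes _  = 0ℤ
    ... | no a≢b = sgn a * sgn (punchOut a≢b) * D a (punchOut a≢b)

    coeff-diag : ∀ a → coeff a a ≡ 0ℤ
    coeff-diag a with a ≟ a
    ... | yes _  = refl
    ... | no a≢a = contradiction refl a≢a

    coeff-punchIn : ∀ a l → coeff a (punchIn a l) ≡ sgn a * sgn l * D a l
    coeff-punchIn a l with a ≟ punchIn a l
    ... | yes a≡ = contradiction (sym a≡) (punchInᵢ≢i a l)
    ... | no a≢  = cong (λ k → sgn a * sgn k * D a k) (trans (punchOut-cong a refl) (punchOut-punchIn a))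

    coeff-antisym : ∀ a b → coeff b a ≡ - coeff a b
    coeff-antisym a b with a ≟ b | b ≟ a
    ... | yes _   | yes _   = refl
    ... | yes a≡b | no b≢a  = contradiction (sym a≡b) b≢a
    ... | no a≢b  | yes b≡a = contradiction (sym b≡a) a≢b
    ... | no a≢b  | no b≢a  = begin
      sgn b * sgn (punchOut b≢a) * D b (punchOut b≢a)  ≡⟨ cong (sgn b * sgn (punchOut b≢a) *_) (D-sym a≢b b≢a) ⟨
      sgn b * sgn (punchOut b≢a) * d                   ≡⟨ cong (_* d) (sgn-punchOut a≢b b≢a) ⟩
      - s * d                                          ≡⟨ ℤP.neg-distribˡ-* s d ⟨
      - (s * d)                                        ∎
      where
      s = sgn a * sgn (punchOut a≢b)
      d = D a (punchOut a≢b)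

    pairSum : Vector ℤ N → Vector ℤ N → ℤ
    pairSum x y = ∑[ a < N ] ∑[ b < N ] (coeff a b * (x a * y b))

    Φ≡pairSum : ∀ x y → Φ x y ≡ pairSum x y
    Φ≡pairSum x y = trans (sumFin≡sum N outer) (sum-cong-≗ row)
      where
      inner : Fin N → Vector ℤ (suc n)
      inner a l = sgn l * (y (punchIn a l) * D a l)
      outer : Vector ℤ N
      outer a = sgn a * (x a * sumFin (suc n) (inner a))
      reassoc : ∀ s x t y d → s * (x * (t * (y * d))) ≡ s * t * d * (x * y)
      reassoc = solve-∀
      row : ∀ a → outer a ≡ ∑[ b < N ] (coeff a b * (x a * y b))
      row a = begin
        sgn a * (x a * sumFin (suc n) (inner a))    ≡⟨ cong (λ s → sgn a * (x a * s)) (sumFin≡sum (suc n) (inner a)) ⟩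
        sgn a * (x a * sum (inner a))               ≡⟨ cong (sgn a *_) (*-distribˡ-sum (x a) (inner a)) ⟩
        sgn a * ∑[ l < suc n ] (x a * inner a l)    ≡⟨ *-distribˡ-sum (sgn a) (λ l → x a * inner a l) ⟩
        ∑[ l < suc n ] (sgn a * (x a * inner a l))  ≡⟨ sum-cong-≗ term ⟩
        sum (g ∘ punchIn a)                         ≡⟨ ℤP.+-identityˡ (sum (g ∘ punchIn a)) ⟨
        0ℤ + sum (g ∘ punchIn a)                    ≡⟨ cong (λ c → c * (x a * y a) + sum (g ∘ punchIn a)) (coeff-diag a) ⟨
        g a + sum (g ∘ punchIn a)                   ≡⟨ sum-remove g ⟨
        sum g                                       ∎
        where
        g : Vector ℤ N
        g b = coeff a b * (x a * y b)
        term : ∀ l → sgn a * (x a * inner a l) ≡ g (punchIn a l)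
        term l = trans (reassoc (sgn a) (x a) (sgn l) (y (punchIn a l)) (D a l))
                       (cong (_* (x a * y (punchIn a l))) (sym (coeff-punchIn a l)))

    pairSum-antisym : ∀ x y → pairSum y x ≡ - pairSum x y
    pairSum-antisym x y = begin
      pairSum y x                             ≡⟨ ∑-comm (λ a b → coeff a b * (y a * x b)) ⟩
      ∑[ a < N ] ∑[ b < N ] (coeff b a * (y b * x a))  ≡⟨ sum-cong-≗ (λ a → sum-cong-≗ (term a)) ⟩
      ∑[ a < N ] ∑[ b < N ] (- t a b)         ≡⟨ sum-cong-≗ (λ a → neg-sum (t a)) ⟨
      ∑[ a < N ] (- ∑[ b < N ] t a b)         ≡⟨ neg-sum (λ a → ∑[ b < N ] t a b) ⟨
      - pairSum x y                           ∎
      where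
      t : Fin N → Fin N → ℤ
      t a b = coeff a b * (x a * y b)
      term : ∀ a b → coeff b a * (y b * x a) ≡ - t a b
      term a b = begin
        coeff b a * (y b * x a)    ≡⟨ cong₂ _*_ (coeff-antisym a b) (ℤP.*-comm (y b) (x a)) ⟩
        - coeff a b * (x a * y b)  ≡⟨ ℤP.neg-distribˡ-* (coeff a b) (x a * y b) ⟨
        - t a b                    ∎

  Φ-antisym : ∀ x y → Φ y x ≡ - Φ x y
  Φ-antisym x y = begin
    Φ y x          ≡⟨ Φ≡pairSum y x ⟩
    pairSum y x    ≡⟨ pairSum-antisym x y ⟩
    - pairSum x y  ≡⟨ cong -_ (Φ≡pairSum x y) ⟨
    - Φ x y        ∎

det-expand : ∀ {n} (M : Matrix (suc n)) → det M ≡ ∑[ j < suc n ] (sgn j * (M zero j * det (minor j M)))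
det-expand M = sumFin≡sum _ (λ j → sgn j * (M zero j * det (minor j M)))

det-cong : ∀ {n} {M N : Matrix n} → (∀ r c → M r c ≡ N r c) → det M ≡ det N
det-cong {zero}  _   = refl
det-cong {suc n} {M} {N} M≗N = begin
  det M                                                  ≡⟨ det-expand M ⟩
  ∑[ j < suc n ] (sgn j * (M zero j * det (minor j M)))  ≡⟨ sum-cong-≗ (λ j → cong₂ (λ a d → sgn j * (a * d))
                                                              (M≗N zero j) (det-cong (λ r c → M≗N (suc r) (punchIn j c)))) ⟩
  ∑[ j < suc n ] (sgn j * (N zero j * det (minor j N)))  ≡⟨ det-expand N ⟨
  det N                                                  ∎

swapRows01 : ∀ {n} → Matrix (suc (suc n)) → Matrix (suc (suc n))
swapRows01 M = M (suc zero) ∷ᵥ M zero ∷ᵥ λ r → M (suc (suc r))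

-- Both determinants unfold definitionally to the two-row expansion Φ, with the rows exchanged.
det-swapRows01 : ∀ {n} (M : Matrix (suc (suc n))) → det (swapRows01 M) ≡ - det M
det-swapRows01 M = Φ-antisym (M zero) (M (suc zero))
  where
  open TwoRowExpansion (λ a l → det (λ r c → M (suc (suc r)) (punchIn a (punchIn l c))))
    (λ a≢b b≢a → det-cong (λ r c → cong (M _) (punchIn-punchOut-comm a≢b b≢a c)))

det≡-det-swapRows01 : ∀ {n} (M : Matrix (suc (suc n))) → det M ≡ - det (swapRows01 M)
det≡-det-swapRows01 M = trans (sym (ℤP.neg-involutive (det M))) (cong -_ (sym (det-swapRows01 M)))

det-moveToTop : ∀ {n} (k : Fin (suc n)) (M : Matrix (suc n)) → det (M k ∷ᵥ removeAt M k) ≡ sgn k * det M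
det-moveToTop zero M =
  trans (det-cong {M = M zero ∷ᵥ removeAt M zero} {N = M} (λ { zero c → refl ; (suc r) c → refl }))
        (sym (ℤP.*-identityˡ (det M)))
det-moveToTop {suc n} (suc k) M = begin
  det T                                                       ≡⟨ det≡-det-swapRows01 T ⟩
  - det (swapRows01 T)                                        ≡⟨ cong -_ (det-expand (swapRows01 T)) ⟩
  - ∑[ j < suc (suc n) ] (sgn j * (M zero j * det (minor j (swapRows01 T))))
                                                              ≡⟨ cong -_ (sum-cong-≗ expand-minor) ⟩
  - ∑[ j < suc (suc n) ] (sgn k * e j)                        ≡⟨ cong -_ (*-distribˡ-sum (sgn k) e) ⟨
  - (sgn k * sum e)                                           ≡⟨ cong (λ d → - (sgn k * d)) (det-expand M) ⟨
  - (sgn k * det M)                                           ≡⟨ ℤP.neg-distribˡ-* (sgn k) (det M) ⟩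
  - sgn k * det M                                             ≡⟨ cong (_* det M) (sign-suc (toℕ k)) ⟨
  sgn (suc k) * det M                                         ∎
  where
  T = M (suc k) ∷ᵥ removeAt M (suc k)
  e : Vector ℤ (suc (suc n))
  e j = sgn j * (M zero j * det (minor j M))
  pull : ∀ s a t d → s * (a * (t * d)) ≡ t * (s * (a * d))
  pull = solve-∀
  expand-minor : ∀ j → sgn j * (M zero j * det (minor j (swapRows01 T))) ≡ sgn k * e j
  expand-minor j = begin
    sgn j * (M zero j * det (minor j (swapRows01 T)))
      ≡⟨ cong (λ d → sgn j * (M zero j * d))
           (det-cong {M = minor j (swapRows01 T)} {N = minor j M k ∷ᵥ removeAt (minor j M) k}
                     (λ { zero c → refl ; (suc r) c → refl })) ⟩
    sgn j * (M zero j * det (minor j M k ∷ᵥ removeAt (minor j M) k))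
      ≡⟨ cong (λ d → sgn j * (M zero j * d)) (det-moveToTop k (minor j M)) ⟩
    sgn j * (M zero j * (sgn k * det (minor j M)))
      ≡⟨ pull (sgn j) (M zero j) (sgn k) (det (minor j M)) ⟩
    sgn k * e j ∎

det-repeatedRow : ∀ {n} (M : Matrix (suc n)) (r : Fin n) → (∀ c → M zero c ≡ M (suc r) c) → det M ≡ 0ℤ
det-repeatedRow M zero M₀≗M₁ = self-neg⇒0 (det M) (begin
  det M                 ≡⟨ det≡-det-swapRows01 M ⟩
  - det (swapRows01 M)  ≡⟨ cong -_ (det-cong {M = swapRows01 M} {N = M} swap≗M) ⟩
  - det M               ∎)
  where
  swap≗M : ∀ r c → swapRows01 M r c ≡ M r c
  swap≗M zero          c = sym (M₀≗M₁ c)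
  swap≗M (suc zero)    c = M₀≗M₁ c
  swap≗M (suc (suc r)) c = refl
det-repeatedRow {suc n} M (suc r) M₀≗Mᵣ = begin
  det M                 ≡⟨ det≡-det-swapRows01 M ⟩
  - det (swapRows01 M)  ≡⟨ cong -_ (det-expand (swapRows01 M)) ⟩
  - ∑[ j < suc (suc n) ] (sgn j * (M (suc zero) j * det (minor j (swapRows01 M))))
                        ≡⟨ cong -_ (sum-zero _ vanishing-minor) ⟩
  - 0ℤ                  ∎
  where
  vanishing-minor : ∀ j → sgn j * (M (suc zero) j * det (minor j (swapRows01 M))) ≡ 0ℤ
  vanishing-minor j = begin
    sgn j * (M (suc zero) j * det (minor j (swapRows01 M)))
      ≡⟨ cong (λ d → sgn j * (M (suc zero) j * d))
              (det-repeatedRow (minor j (swapRows01 M)) r (M₀≗Mᵣ ∘ punchIn j)) ⟩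
    sgn j * (M (suc zero) j * 0ℤ)  ≡⟨ cong (sgn j *_) (ℤP.*-zeroʳ (M (suc zero) j)) ⟩
    sgn j * 0ℤ                     ≡⟨ ℤP.*-zeroʳ (sgn j) ⟩
    0ℤ                             ∎

infixr 7 _*ᵥ_

_*ᵥ_ : ∀ {n} → Matrix n → Vector ℤ n → Vector ℤ n
_*ᵥ_ {n} M x i = ∑[ j < n ] (M i j * x j)

*ᵥ-cong : ∀ {n} (M : Matrix n) {x y : Vector ℤ n} → x ≗ y → M *ᵥ x ≗ M *ᵥ y
*ᵥ-cong M x≗y i = sum-cong-≗ (λ j → cong (M i j *_) (x≗y j))

*ᵥ-distrib-+ : ∀ {n} (M : Matrix n) (x y : Vector ℤ n) →
  M *ᵥ (λ j → x j + y j) ≗ λ i → (M *ᵥ x) i + (M *ᵥ y) i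
*ᵥ-distrib-+ M x y i = trans (sum-cong-≗ (λ j → ℤP.*-distribˡ-+ (M i j) (x j) (y j)))
                             (∑-distrib-+ (λ j → M i j * x j) (λ j → M i j * y j))

*ᵥ-*ʳ : ∀ {n} (M : Matrix n) (x : Vector ℤ n) c → M *ᵥ (λ j → x j * c) ≗ λ i → (M *ᵥ x) i * c
*ᵥ-*ʳ M x c i = trans (sum-cong-≗ (λ j → sym (ℤP.*-assoc (M i j) (x j) c)))
                      (sym (*-distribʳ-sum c (λ j → M i j * x j)))

cofactor : ∀ {n} → Matrix (suc n) → Fin (suc n) → Fin (suc n) → ℤ
cofactor M i j = sgn i * (sgn j * det (λ r c → M (punchIn i r) (punchIn j c)))

∑-*-cofactor : ∀ {n} (M : Matrix (suc n)) i (x : Vector ℤ (suc n)) →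
  ∑[ j < suc n ] (x j * cofactor M i j) ≡ sgn i * det (x ∷ᵥ removeAt M i)
∑-*-cofactor {n} M i x = begin
  ∑[ j < suc n ] (x j * cofactor M i j)           ≡⟨ sum-cong-≗ (λ j → pull (x j) (sgn i) (sgn j) (d j)) ⟩
  ∑[ j < suc n ] (sgn i * (sgn j * (x j * d j)))  ≡⟨ *-distribˡ-sum (sgn i) (λ j → sgn j * (x j * d j)) ⟨
  sgn i * ∑[ j < suc n ] (sgn j * (x j * d j))    ≡⟨ cong (sgn i *_) (det-expand (x ∷ᵥ removeAt M i)) ⟨
  sgn i * det (x ∷ᵥ removeAt M i)                 ∎
  where
  d : Fin (suc n) → ℤ
  d j = det (λ r c → M (punchIn i r) (punchIn j c))
  pull : ∀ a s t e → a * (s * (t * e)) ≡ s * (t * (a * e))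
  pull = solve-∀

cofactor-expansion : ∀ {n} (M : Matrix (suc n)) i → ∑[ j < suc n ] (M i j * cofactor M i j) ≡ det M
cofactor-expansion M i = begin
  ∑[ j < _ ] (M i j * cofactor M i j)  ≡⟨ ∑-*-cofactor M i (M i) ⟩
  sgn i * det (M i ∷ᵥ removeAt M i)    ≡⟨ cong (sgn i *_) (det-moveToTop i M) ⟩
  sgn i * (sgn i * det M)              ≡⟨ ℤP.*-assoc (sgn i) (sgn i) (det M) ⟨
  sgn i * sgn i * det M                ≡⟨ cong (_* det M) (sgn-square i) ⟩
  1ℤ * det M                           ≡⟨ ℤP.*-identityˡ (det M) ⟩
  det M                                ∎

cofactor-expansion-alien : ∀ {n} (M : Matrix (suc n)) {i k} → i ≢ k →
  ∑[ j < suc n ] (M k j * cofactor M i j) ≡ 0ℤ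
cofactor-expansion-alien M {i} {k} i≢k = begin
  ∑[ j < _ ] (M k j * cofactor M i j)  ≡⟨ ∑-*-cofactor M i (M k) ⟩
  sgn i * det (M k ∷ᵥ removeAt M i)    ≡⟨ cong (sgn i *_) (det-repeatedRow (M k ∷ᵥ removeAt M i) (punchOut i≢k)
                                            (λ c → cong (λ r → M r c) (sym (punchIn-punchOut i≢k)))) ⟩
  sgn i * 0ℤ                           ≡⟨ ℤP.*-zeroʳ (sgn i) ⟩
  0ℤ                                   ∎

adjugate : ∀ {n} → Matrix (suc n) → Matrix (suc n)
adjugate M j i = cofactor M i j

*ᵥ-adjugate : ∀ {n} (M : Matrix (suc n)) (t : Vector ℤ (suc n)) → M *ᵥ adjugate M *ᵥ t ≗ λ k → det M * t k
*ᵥ-adjugate {n} M t k = begin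
  ∑[ j < suc n ] (M k j * ∑[ i < suc n ] (cofactor M i j * t i))
    ≡⟨ sum-cong-≗ (λ j → *-distribˡ-sum (M k j) (λ i → cofactor M i j * t i)) ⟩
  ∑[ j < suc n ] ∑[ i < suc n ] (M k j * (cofactor M i j * t i))
    ≡⟨ ∑-comm (λ j i → M k j * (cofactor M i j * t i)) ⟩
  ∑[ i < suc n ] ∑[ j < suc n ] (M k j * (cofactor M i j * t i))
    ≡⟨ sum-cong-≗ (λ i → trans (*-distribʳ-sum (t i) (λ j → M k j * cofactor M i j))
                               (sum-cong-≗ (λ j → ℤP.*-assoc (M k j) (cofactor M i j) (t i)))) ⟨
  ∑[ i < suc n ] (e i * t i)
    ≡⟨ sum-remove {i = k} (λ i → e i * t i) ⟩
  e k * t k + ∑[ l < n ] (e (punchIn k l) * t (punchIn k l))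
    ≡⟨ cong₂ _+_ (cong (_* t k) (cofactor-expansion M k)) (sum-zero n alien) ⟩
  det M * t k + 0ℤ
    ≡⟨ ℤP.+-identityʳ (det M * t k) ⟩
  det M * t k ∎
  where
  e : Fin (suc n) → ℤ
  e i = ∑[ j < suc n ] (M k j * cofactor M i j)
  alien : ∀ l → e (punchIn k l) * t (punchIn k l) ≡ 0ℤ
  alien l = trans (cong (_* t (punchIn k l)) (cofactor-expansion-alien M (punchInᵢ≢i k l)))
                  (ℤP.*-zeroˡ (t (punchIn k l)))

unimodular⇒surjective : ∀ {n} (M : Matrix (suc n)) → det M ≡ 1ℤ ⊎ det M ≡ - 1ℤ →
  ∀ t → ∃[ x ] M *ᵥ x ≗ t
unimodular⇒surjective M det±1 t = adjugate M *ᵥ (λ k → det M * t k) , λ k → begin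
  (M *ᵥ adjugate M *ᵥ (λ k → det M * t k)) k  ≡⟨ *ᵥ-adjugate M (λ k → det M * t k) k ⟩
  det M * (det M * t k)                       ≡⟨ ℤP.*-assoc (det M) (det M) (t k) ⟨
  det M * det M * t k                         ≡⟨ cong (_* t k) (±1-square det±1) ⟩
  1ℤ * t k                                    ≡⟨ ℤP.*-identityˡ (t k) ⟩
  t k                                         ∎

-- Congruences

infix 4 _≡_[mod_]

_≡_[mod_] : ℤ → ℤ → ℕ → Set
x ≡ y [mod m ] = ∃[ q ] x ≡ y + q * + m

*ᵥ-cong-[mod] : ∀ {n m} (M : Matrix n) {x y : Vector ℤ n} → (∀ j → x j ≡ y j [mod m ]) →
  ∀ i → (M *ᵥ x) i ≡ (M *ᵥ y) i [mod m ]
*ᵥ-cong-[mod] {m = m} M {x} {y} x≡y i = (M *ᵥ q) i , (begin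
  (M *ᵥ x) i                               ≡⟨ *ᵥ-cong M (λ j → proj₂ (x≡y j)) i ⟩
  (M *ᵥ (λ j → y j + q j * + m)) i         ≡⟨ *ᵥ-distrib-+ M y (λ j → q j * + m) i ⟩
  (M *ᵥ y) i + (M *ᵥ (λ j → q j * + m)) i  ≡⟨ cong (_+_ ((M *ᵥ y) i)) (*ᵥ-*ʳ M q (+ m) i) ⟩
  (M *ᵥ y) i + (M *ᵥ q) i * + m            ∎)
  where
  q : Vector ℤ _
  q j = proj₁ (x≡y j)

%ℕ≡⇒≡[mod] : ∀ {x y} m .{{_ : NonZero m}} → x %ℕ m ≡ y %ℕ m → x ≡ y [mod m ]
%ℕ≡⇒≡[mod] {x} {y} m x%≡y% = x /ℕ m - y /ℕ m , (begin
  x                                                    ≡⟨ a≡a%ℕn+[a/ℕn]*n x m ⟩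
  + (x %ℕ m) + x /ℕ m * + m                            ≡⟨ cong (λ r → + r + x /ℕ m * + m) x%≡y% ⟩
  + (y %ℕ m) + x /ℕ m * + m                            ≡⟨ regroup (+ (y %ℕ m)) (x /ℕ m) (y /ℕ m) (+ m) ⟩
  (+ (y %ℕ m) + y /ℕ m * + m) + (x /ℕ m - y /ℕ m) * + m  ≡⟨ cong (_+ (x /ℕ m - y /ℕ m) * + m) (a≡a%ℕn+[a/ℕn]*n y m) ⟨
  y + (x /ℕ m - y /ℕ m) * + m                          ∎)
  where
  regroup : ∀ r a b m → r + a * m ≡ (r + b * m) + (a - b) * m
  regroup = solve-∀

≡[mod]⇒%≡ : ∀ {N r m} .{{_ : NonZero m}} → + N ≡ + r [mod m ] → r < m → N % m ≡ r
≡[mod]⇒%≡ {N} {r} {m} (+ k , N≡) r<m = begin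
  N % m                  ≡⟨ %-congˡ (ℤP.+-injective N≡r+km) ⟩
  (r ℕ.+ k ℕ.* m) % m    ≡⟨ [m+kn]%n≡m%n r k m ⟩
  r % m                  ≡⟨ m<n⇒m%n≡m r<m ⟩
  r                      ∎
  where
  N≡r+km : + N ≡ + (r ℕ.+ k ℕ.* m)
  N≡r+km = begin
    + N                      ≡⟨ N≡ ⟩
    + r + + k * + m          ≡⟨ cong (_+_ (+ r)) (ℤP.pos-* k m) ⟨
    + r + + (k ℕ.* m)        ≡⟨ ℤP.pos-+ r (k ℕ.* m) ⟨
    + (r ℕ.+ k ℕ.* m)        ∎
≡[mod]⇒%≡ {N} {r} {m} (-[1+ k ] , N≡) r<m = begin
  N % m                      ≡⟨ [m+kn]%n≡m%n N (suc k) m ⟨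
  (N ℕ.+ suc k ℕ.* m) % m    ≡⟨ %-congˡ (ℤP.+-injective r≡N+km) ⟨
  r % m                      ≡⟨ m<n⇒m%n≡m r<m ⟩
  r                          ∎
  where
  cancel : ∀ r q m → r ≡ (r + q * m) + - q * m
  cancel = solve-∀
  r≡N+km : + r ≡ + (N ℕ.+ suc k ℕ.* m)
  r≡N+km = begin
    + r                                      ≡⟨ cancel (+ r) -[1+ k ] (+ m) ⟩
    (+ r + -[1+ k ] * + m) + + suc k * + m   ≡⟨ cong (_+ + suc k * + m) N≡ ⟨
    + N + + suc k * + m                      ≡⟨ cong (_+_ (+ N)) (ℤP.pos-* (suc k) m) ⟨
    + N + + (suc k ℕ.* m)                    ≡⟨ ℤP.pos-+ N (suc k ℕ.* m) ⟨
    + (N ℕ.+ suc k ℕ.* m)                    ∎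

-- Prefixes and occurrences

++-injective : ∀ {A : Set} {xs ys xs′ ys′ : List A} → length xs ≡ length ys → xs ++ xs′ ≡ ys ++ ys′ →
  xs ≡ ys × xs′ ≡ ys′
++-injective {xs = []}     {[]}     _   eq = refl , eq
++-injective {xs = x ∷ xs} {y ∷ ys} len eq with ∷-injective eq
... | x≡y , eq′ = map₁ (cong₂ _∷_ x≡y) (++-injective (ℕP.suc-injective len) eq′)

applyUpTo-cong : ∀ {A : Set} {f g : ℕ → A} → f ≗ g → ∀ n → applyUpTo f n ≡ applyUpTo g n
applyUpTo-cong {f = f} {g} f≗g n = begin
  applyUpTo f n   ≡⟨ map-upTo f n ⟨
  map f (upTo n)  ≡⟨ map-cong f≗g (upTo n) ⟩
  map g (upTo n)  ≡⟨ map-upTo g n ⟩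
  applyUpTo g n   ∎

length-prefix-≡ : ∀ {σ} (v w : InfWord σ) n → length (prefix v n) ≡ length (prefix w n)
length-prefix-≡ v w n = trans (length-applyUpTo v n) (sym (length-applyUpTo w n))

prefix-+ : ∀ {σ} (w : InfWord σ) m k → prefix w (m ℕ.+ k) ≡ prefix w m ++ factorAt w m k
prefix-+ w zero    k = refl
prefix-+ w (suc m) k = cong (w 0 ∷_) (prefix-+ (w ∘ suc) m k)

prefix-agree : ∀ {σ} {v w : InfWord σ} {N n} → prefix v N ≡ prefix w N → n ≤ N → prefix v n ≡ prefix w n
prefix-agree {v = v} {w} {N} {n} vN≡wN n≤N = proj₁ (++-injective (length-prefix-≡ v w n) (begin
  prefix v n ++ factorAt v n (N ∸ n)  ≡⟨ prefix-+ v n (N ∸ n) ⟨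
  prefix v (n ℕ.+ (N ∸ n))            ≡⟨ cong (prefix v) (ℕP.m+[n∸m]≡n n≤N) ⟩
  prefix v N                          ≡⟨ vN≡wN ⟩
  prefix w N                          ≡⟨ cong (prefix w) (ℕP.m+[n∸m]≡n n≤N) ⟨
  prefix w (n ℕ.+ (N ∸ n))            ≡⟨ prefix-+ w n (N ∸ n) ⟩
  prefix w n ++ factorAt w n (N ∸ n)  ∎))

factorAt-agree : ∀ {σ} {v w : InfWord σ} {N} → prefix v N ≡ prefix w N →
  ∀ a k → a ℕ.+ k ≤ N → factorAt v a k ≡ factorAt w a k
factorAt-agree {v = v} {w} vN≡wN a k a+k≤N = proj₂ (++-injective (length-prefix-≡ v w a) (begin
  prefix v a ++ factorAt v a k  ≡⟨ prefix-+ v a k ⟨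
  prefix v (a ℕ.+ k)            ≡⟨ prefix-agree vN≡wN a+k≤N ⟩
  prefix w (a ℕ.+ k)            ≡⟨ prefix-+ w a k ⟩
  prefix w a ++ factorAt w a k  ∎))

IsPrefixOf : ∀ {σ} → Word σ → InfWord σ → Set
IsPrefixOf u w = prefix w (length u) ≡ u

isPrefixOf-++⁻ : ∀ {σ} {u v : Word σ} {w : InfWord σ} → IsPrefixOf (u ++ v) w →
  IsPrefixOf u w × factorAt w (length u) (length v) ≡ v
isPrefixOf-++⁻ {u = u} {v} {w} uv⊑w = ++-injective (length-applyUpTo w (length u)) (begin
  prefix w (length u) ++ factorAt w (length u) (length v)  ≡⟨ prefix-+ w (length u) (length v) ⟨
  prefix w (length u ℕ.+ length v)                         ≡⟨ cong (prefix w) (length-++ u) ⟨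
  prefix w (length (u ++ v))                               ≡⟨ uv⊑w ⟩
  u ++ v                                                   ∎)

occursAt-shift : ∀ {σ} {y z u : Word σ} {w : InfWord σ} {b} → IsPrefixOf (y ++ z) w → IsPrefixOf z w →
  b ℕ.+ length u ≤ length z → OccursAt w u b →
  OccursAt w u (length y ℕ.+ b) × prefix w (length y ℕ.+ b) ≡ y ++ prefix w b
occursAt-shift {y = y} {z} {u} {w} {b} yz⊑w z⊑w b+u≤z occ-b = occurs , prefix-shift
  where
  shifted : InfWord _
  shifted i = w (length y ℕ.+ i)
  agree : prefix shifted (length z) ≡ prefix w (length z)
  agree = trans (proj₂ (isPrefixOf-++⁻ yz⊑w)) (sym z⊑w)
  occurs : OccursAt w u (length y ℕ.+ b)
  occurs = begin
    factorAt w (length y ℕ.+ b) (length u)  ≡⟨ applyUpTo-cong (λ i → cong w (ℕP.+-assoc (length y) b i)) (length u) ⟩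
    factorAt shifted b (length u)           ≡⟨ factorAt-agree agree b (length u) b+u≤z ⟩
    factorAt w b (length u)                 ≡⟨ occ-b ⟩
    u                                       ∎
  prefix-shift : prefix w (length y ℕ.+ b) ≡ y ++ prefix w b
  prefix-shift = begin
    prefix w (length y ℕ.+ b)                ≡⟨ prefix-+ w (length y) b ⟩
    prefix w (length y) ++ prefix shifted b  ≡⟨ cong₂ _++_ (proj₁ (isPrefixOf-++⁻ yz⊑w))
                                                  (factorAt-agree agree 0 b (ℕP.m+n≤o⇒m≤o b b+u≤z)) ⟩
    y ++ prefix w b                          ∎

-- Morphisms and Parikh vectors

iter-++ : ∀ {σ} (φ : Morphism σ) k (u v : Word σ) → iter φ k (u ++ v) ≡ iter φ k u ++ iter φ k v
iter-++ φ zero    u v = refl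
iter-++ φ (suc k) u v = trans (cong (apply φ) (iter-++ φ k u v)) (concatMap-++ φ (iter φ k u) (iter φ k v))

iter-+ : ∀ {σ} (φ : Morphism σ) k j (u : Word σ) → iter φ (k ℕ.+ j) u ≡ iter φ k (iter φ j u)
iter-+ φ zero    j u = refl
iter-+ φ (suc k) j u = cong (apply φ) (iter-+ φ k j u)

≢[]⇒1≤length : ∀ {A : Set} {xs : List A} → xs ≢ [] → 1 ≤ length xs
≢[]⇒1≤length {xs = []}    xs≢[] = contradiction refl xs≢[]
≢[]⇒1≤length {xs = _ ∷ _} _     = s≤s z≤n

length-apply : ∀ {σ} {φ : Morphism σ} → Nonerasing φ → ∀ u → length u ≤ length (apply φ u)
length-apply         φ≢[] []      = z≤n
length-apply {φ = φ} φ≢[] (a ∷ u) = ℕP.≤-trans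
  (ℕP.+-mono-≤ (≢[]⇒1≤length (φ≢[] a)) (length-apply φ≢[] u))
  (ℕP.≤-reflexive (sym (length-++ (φ a))))

parikh : ∀ {σ} → Word σ → Vector ℤ σ
parikh u j = + occ j u

parikh-++ : ∀ {σ} (u v : Word σ) j → parikh (u ++ v) j ≡ parikh u j + parikh v j
parikh-++ u v j = trans (cong (+_) (trans (cong length (filter-++ (_≟ j) u v)) (length-++ (filter (_≟ j) u))))
                        (ℤP.pos-+ (occ j u) (occ j v))

*ᵥ-parikh-letter : ∀ {n} (M : Matrix (suc n)) a → M *ᵥ parikh [ a ] ≗ λ i → M i a
*ᵥ-parikh-letter {n} M a i = begin
  ∑[ j < suc n ] (M i j * parikh [ a ] j)       ≡⟨ sum-remove {i = a} (λ j → M i j * parikh [ a ] j) ⟩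
  M i a * parikh [ a ] a + ∑[ l < n ] (M i (punchIn a l) * parikh [ a ] (punchIn a l))
                                                ≡⟨ cong₂ _+_ (cong (λ s → M i a * + length s) (filter-accept (_≟ a) refl))
                                                             (sum-zero n absent) ⟩
  M i a * 1ℤ + 0ℤ                               ≡⟨ ℤP.+-identityʳ (M i a * 1ℤ) ⟩
  M i a * 1ℤ                                    ≡⟨ ℤP.*-identityʳ (M i a) ⟩
  M i a                                         ∎
  where
  absent : ∀ l → M i (punchIn a l) * parikh [ a ] (punchIn a l) ≡ 0ℤ
  absent l = trans (cong (λ s → M i (punchIn a l) * + length s) (filter-reject (_≟ punchIn a l) (punchInᵢ≢i a l ∘ sym)))
                   (ℤP.*-zeroʳ (M i (punchIn a l)))

parikh-apply : ∀ {n} (φ : Morphism (suc n)) u → parikh (apply φ u) ≗ incidence φ *ᵥ parikh u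
parikh-apply φ []      i = sym (sum-zero _ (λ j → ℤP.*-zeroʳ (incidence φ i j)))
parikh-apply φ (a ∷ u) i = begin
  parikh (φ a ++ apply φ u) i                   ≡⟨ parikh-++ (φ a) (apply φ u) i ⟩
  A i a + parikh (apply φ u) i                  ≡⟨ cong₂ _+_ (sym (*ᵥ-parikh-letter A a i)) (parikh-apply φ u i) ⟩
  (A *ᵥ parikh [ a ]) i + (A *ᵥ parikh u) i     ≡⟨ *ᵥ-distrib-+ A (parikh [ a ]) (parikh u) i ⟨
  (A *ᵥ (λ j → parikh [ a ] j + parikh u j)) i  ≡⟨ *ᵥ-cong A (λ j → parikh-++ [ a ] u j) i ⟨
  (A *ᵥ parikh (a ∷ u)) i                       ∎
  where
  A = incidence φ

parikh-iter-residues : ∀ {n} (φ : Morphism (suc n)) → det (incidence φ) ≡ 1ℤ ⊎ det (incidence φ) ≡ - 1ℤ →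
  ∀ m K (t : Vector ℤ (suc n)) →
  Σ[ x ∈ Vector ℤ (suc n) ]
    (∀ u → (∀ j → parikh u j ≡ x j [mod m ]) → ∀ j → parikh (iter φ K u) j ≡ t j [mod m ])
parikh-iter-residues φ det±1 m zero    t = t , λ u u≡t → u≡t
parikh-iter-residues φ det±1 m (suc K) t =
  let x′ , Ax′≗t      = unimodular⇒surjective (incidence φ) det±1 t
      x  , reaches-x′ = parikh-iter-residues φ det±1 m K x′
  in x , λ u u≡x j → subst₂ (λ p q → p ≡ q [mod m ]) (sym (parikh-apply φ (iter φ K u) j)) (Ax′≗t j)
                       (*ᵥ-cong-[mod] (incidence φ) {y = x′} (reaches-x′ u u≡x) j)

-- Fixed points

iter-seed-shape : ∀ {n} {φ : Morphism (suc n)} {s} → Nonerasing φ → φ zero ≡ zero ∷ s → s ≢ [] →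
  ∀ k → ∃[ r ] (iter φ k [ zero ] ≡ zero ∷ r × k ≤ length r)
iter-seed-shape _ _ _ zero = [] , refl , z≤n
iter-seed-shape {φ = φ} {s} φ≢[] φ0≡0s s≢[] (suc k) =
  let r , φᵏ0≡0r , k≤r = iter-seed-shape φ≢[] φ0≡0s s≢[] k in
  s ++ apply φ r ,
  trans (cong (apply φ) φᵏ0≡0r) (cong (_++ apply φ r) φ0≡0s) ,
  ℕP.≤-trans (ℕP.+-mono-≤ (≢[]⇒1≤length s≢[]) (ℕP.≤-trans k≤r (length-apply φ≢[] r)))
             (ℕP.≤-reflexive (sym (length-++ s)))

length-iter-seed : ∀ {n} {φ : Morphism (suc n)} {w} → GeneratedBy φ w → ∀ k → k < length (iter φ k [ zero ])
length-iter-seed (φ≢[] , (s , φ0≡0s , s≢[]) , _) k with iter-seed-shape φ≢[] φ0≡0s s≢[] k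
... | r , φᵏ0≡0r , k≤r rewrite φᵏ0≡0r = s≤s k≤r

module _ {n} {φ : Morphism (suc n)} {w : InfWord (suc n)} (gen : GeneratedBy φ w) where

  private
    iter-seed-isPrefixOf : ∀ k → IsPrefixOf (iter φ k [ zero ]) w
    iter-seed-isPrefixOf = proj₂ (proj₂ gen)

  -- w[0,N) is a prefix of φ^N(0), so φ^k(w[0,N)) is a prefix of φ^(k+N)(0).
  iter-prefix-isPrefixOf : ∀ N k → IsPrefixOf (iter φ k (prefix w N)) w
  iter-prefix-isPrefixOf N k =
    proj₁ (isPrefixOf-++⁻ (subst (λ u → IsPrefixOf u w) split (iter-seed-isPrefixOf (k ℕ.+ N))))
    where
    L = length (iter φ N [ zero ])
    N≤L = ℕP.<⇒≤ (length-iter-seed gen N)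
    rest = factorAt w N (L ∸ N)
    split : iter φ (k ℕ.+ N) [ zero ] ≡ iter φ k (prefix w N) ++ iter φ k rest
    split = begin
      iter φ (k ℕ.+ N) [ zero ]               ≡⟨ iter-+ φ k N [ zero ] ⟩
      iter φ k (iter φ N [ zero ])            ≡⟨ cong (iter φ k) (iter-seed-isPrefixOf N) ⟨
      iter φ k (prefix w L)                   ≡⟨ cong (iter φ k ∘ prefix w) (ℕP.m+[n∸m]≡n N≤L) ⟨
      iter φ k (prefix w (N ℕ.+ (L ∸ N)))     ≡⟨ cong (iter φ k) (prefix-+ w N (L ∸ N)) ⟩
      iter φ k (prefix w N ++ rest)           ≡⟨ iter-++ φ k (prefix w N) rest ⟩
      iter φ k (prefix w N) ++ iter φ k rest  ∎

  occursAt-after-iter : ∀ {a b} {u : Word (suc n)} → w a ≡ zero → OccursAt w u b →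
    let Y = iter φ (b ℕ.+ length u) (prefix w a) in
    OccursAt w u (length Y ℕ.+ b) × prefix w (length Y ℕ.+ b) ≡ Y ++ prefix w b
  occursAt-after-iter {a} {b} {u} wa≡0 occ-b =
    occursAt-shift Y-seed-isPrefixOf (iter-seed-isPrefixOf K) (ℕP.<⇒≤ (length-iter-seed gen K)) occ-b
    where
    K = b ℕ.+ length u
    prefix-suc : prefix w (suc a) ≡ prefix w a ++ [ zero ]
    prefix-suc = trans (sym (applyUpTo-∷ʳ w a)) (cong (λ c → prefix w a ++ [ c ]) wa≡0)
    Y-seed-isPrefixOf : IsPrefixOf (iter φ K (prefix w a) ++ iter φ K [ zero ]) w
    Y-seed-isPrefixOf = subst (λ u → IsPrefixOf u w)
      (trans (cong (iter φ K) prefix-suc) (iter-++ φ K (prefix w a) [ zero ]))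
      (iter-prefix-isPrefixOf (suc a) K)

  WELLDOC-for-0⇒WELLDOC : det (incidence φ) ≡ 1ℤ ⊎ det (incidence φ) ≡ - 1ℤ → WELLDOC-for-0 w → WELLDOC w
  WELLDOC-for-0⇒WELLDOC det±1 welldoc₀ u (b , occ-b) m v
    with x , reaches-t ← parikh-iter-residues φ det±1 m (b ℕ.+ length u) (λ j → + toℕ (v j) - parikh (prefix w b) j)
    with a , occ-a , a-residues ← welldoc₀ m (λ j → fromℕ< (n%ℕd<d (x j) m))
    = length Y ℕ.+ b , proj₁ Y+b-occurrence , λ j → ≡[mod]⇒%≡ (residue j) (toℕ<n (v j))
    where
    Y = iter φ (b ℕ.+ length u) (prefix w a)
    wa≡0 : w a ≡ zero
    wa≡0 = trans (cong w (sym (ℕP.+-identityʳ a))) (∷-injectiveˡ occ-a)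
    Y+b-occurrence = occursAt-after-iter wa≡0 occ-b
    a≡x : ∀ j → parikh (prefix w a) j ≡ x j [mod m ]
    a≡x j = %ℕ≡⇒≡[mod] {y = x j} m (trans (a-residues j) (toℕ-fromℕ< (n%ℕd<d (x j) m)))
    cancel : ∀ v p e → (v - p + e) + p ≡ v + e
    cancel = solve-∀
    residue : ∀ j → parikh (prefix w (length Y ℕ.+ b)) j ≡ + toℕ (v j) [mod m ]
    residue j =
      let q , Y≡t = reaches-t (prefix w a) a≡x j
          p = parikh (prefix w b) j
      in q , (begin
        parikh (prefix w (length Y ℕ.+ b)) j   ≡⟨ cong (λ z → parikh z j) (proj₂ Y+b-occurrence) ⟩
        parikh (Y ++ prefix w b) j             ≡⟨ parikh-++ Y (prefix w b) j ⟩
        parikh Y j + p                         ≡⟨ cong (_+ p) Y≡t ⟩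
        (+ toℕ (v j) - p + q * + m) + p        ≡⟨ cancel (+ toℕ (v j)) p (q * + m) ⟩
        + toℕ (v j) + q * + m                  ∎)

lemma1 : ∀ (n : ℕ) (φ : Morphism (suc n)) (w : InfWord (suc n)) →
    w 0 ≡ zero →
    GeneratedBy φ w →
    (det (incidence φ) ≡ 1ℤ ⊎ det (incidence φ) ≡ - 1ℤ) →
    (WELLDOC w ⇔ WELLDOC-for-0 w)
lemma1 n φ w w0≡0 gen det±1 =
  mk⇔ (λ welldoc → welldoc [ zero ] (0 , cong [_] w0≡0)) (WELLDOC-for-0⇒WELLDOC gen det±1)
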